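{- There is no tree that is $\gamma_{tR}$-edge-supercritical.
   Context: All graphs are finite and simple. For a graph $G$ with no isolated vertices, a total Roman dominating function (TRD-function) is a function $f:V(G)\to\{0,1,2\}$ such that every vertex $v$ with $f(v)=0$ is adjacent to some vertex $u$ with $f(u)=2$, and the subgraph induced by $\{w: f(w)>0\}$ has no isolated vertices. Its weight is $\sum_{v}f(v)$, and $\gamma_{tR}(G)$ is the minimum weight of a TRD-function on $G$. A graph $G$ with no isolated vertices is $\gamma_{tR}$-edge-supercritical if $E(\overline{G})\neq\emptyset$ and $\gamma_{tR}(G+e)\leq\gamma_{tR}(G)-2$ for every edge $e\in E(\overline{G})$. -}

module Defs where

open import Level using (0ℓ)
open import Data.Nat using (ℕ; zero; suc; _+_; _∸_; _≤_; _<_)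
open import Data.Fin using (Fin; inject₁; fromℕ)
open import Data.List using (map; allFin)
open import Data.Nat.ListAction using (sum)
open import Data.Product using (Σ; ∃; _×_; _,_)
open import Data.Sum using (_⊎_)
open import Relation.Binary.PropositionalEquality using (_≡_; _≢_)
open import Relation.Nullary using (¬_)
open import Function.Definitions using (Injective)

record Graph : Set₁ where
  field
    n     : ℕ
    Adj   : Fin n → Fin n → Set
    sym   : ∀ {x y} → Adj x y → Adj y x
    irref : ∀ {x} → ¬ Adj x x
open Graph public

NoIsolated : Graph → Set
NoIsolated G = ∀ (v : Fin (n G)) → ∃ λ u → Adj G v u

data Walk (G : Graph) : Fin (n G) → Fin (n G) → Set where
  here : ∀ {v} → Walk G v v
  step : ∀ {u w v} → Adj G u w → Walk G w v → Walk G u v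

Connected : Graph → Set
Connected G = ∀ (u v : Fin (n G)) → Walk G u v

record Cycle (G : Graph) : Set where
  field
    m      : ℕ
    m≥2    : 2 ≤ m
    c      : Fin (suc m) → Fin (n G)
    inj    : Injective _≡_ _≡_ c
    consec : ∀ (i : Fin m) → Adj G (c (inject₁ i)) (c (Data.Fin.suc i))
    close  : Adj G (c (fromℕ m)) (c Data.Fin.zero)

Acyclic : Graph → Set
Acyclic G = ¬ Cycle G

IsTree : Graph → Set
IsTree G = Connected G × Acyclic G

weight : (G : Graph) → (Fin (n G) → ℕ) → ℕ
weight G f = sum (map f (allFin (n G)))

IsTRDF : (G : Graph) → (Fin (n G) → ℕ) → Set
IsTRDF G f =
  (∀ v → f v ≤ 2) ×
  (∀ v → f v ≡ 0 → ∃ λ u → Adj G v u × f u ≡ 2) ×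
  (∀ v → 0 < f v → ∃ λ u → Adj G v u × 0 < f u)

IsγtR : Graph → ℕ → Set
IsγtR G k =
  (∃ λ f → IsTRDF G f × weight G f ≡ k) ×
  (∀ f → IsTRDF G f → k ≤ weight G f)

NonEdge : (G : Graph) → Fin (n G) → Fin (n G) → Set
NonEdge G u v = u ≢ v × ¬ Adj G u v

addEdge : (G : Graph) (u v : Fin (n G)) → u ≢ v → Graph
addEdge G u v u≢v = record
  { n     = n G
  ; Adj   = λ x y → Adj G x y ⊎ ((x ≡ u × y ≡ v) ⊎ (x ≡ v × y ≡ u))
  ; sym   = symm
  ; irref = irr
  }
  where
  open import Data.Sum using (inj₁; inj₂)
  open import Relation.Binary.PropositionalEquality using (trans)
  symm : ∀ {x y} → Adj G x y ⊎ ((x ≡ u × y ≡ v) ⊎ (x ≡ v × y ≡ u))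
               → Adj G y x ⊎ ((y ≡ u × x ≡ v) ⊎ (y ≡ v × x ≡ u))
  symm (inj₁ a) = inj₁ (Graph.sym G a)
  symm (inj₂ (inj₁ (p , q))) = inj₂ (inj₂ (q , p))
  symm (inj₂ (inj₂ (p , q))) = inj₂ (inj₁ (q , p))
  irr : ∀ {x} → ¬ (Adj G x x ⊎ ((x ≡ u × x ≡ v) ⊎ (x ≡ v × x ≡ u)))
  irr (inj₁ a) = Graph.irref G a
  irr (inj₂ (inj₁ (p , q))) = u≢v (trans (Relation.Binary.PropositionalEquality.sym p) q)
  irr (inj₂ (inj₂ (p , q))) = u≢v (trans (Relation.Binary.PropositionalEquality.sym q) p)

EdgeSupercritical : Graph → Set
EdgeSupercritical G =
  NoIsolated G ×
  (∃ λ u → ∃ λ v → NonEdge G u v) ×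
  (∀ u v → (ne : NonEdge G u v) →
     ∀ k k' → IsγtR G k → IsγtR (addEdge G u v (Data.Product.proj₁ ne)) k' →
     k' ≤ k ∸ 2)

-- A supercritical graph has no non-edge xy such that every TRDF of G + xy can be turned
-- into a TRDF of G at extra weight at most one, since that gives γtR(G) ≤ γtR(G + xy) + 1.
-- In a tree with a non-edge, the end of a longest path yields such an xy in one of two
-- configurations. Either x and y are leaves on a common neighbour w: make w a 2 if it is
-- positive, and a 1 otherwise, for then x and y are positive. Or x is a support vertex of
-- degree two, with leaf v₀ and other neighbour v₂, and y ≠ x is a neighbour of v₂: make v₂
-- a 2 if it is positive, and a 1 otherwise, unless y was dominated only through the new
-- edge, in which case the value of v₀ is moved to v₂ and v₂ becomes a 2.
module Submission where

open import Defs hiding (sym)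
open import Data.Empty using (⊥-elim)
open import Data.Fin using (Fin; zero; suc; toℕ) renaming (_≟_ to _≟ᶠ_)
open import Data.Fin.Properties using (pigeonhole; toℕ-injective; toℕ<n; toℕ-inject₁; toℕ-fromℕ)
open import Data.List using (tabulate)
open import Data.List.Properties using (map-tabulate)
open import Data.Nat using (ℕ; zero; suc; _+_; _∸_; _≤_; _<_; z≤n; s≤s; s≤s⁻¹; z<s; s<s; _≟_)
open import Data.Nat.Induction using (<-rec)
open import Data.Nat.ListAction using (sum)
open import Data.Nat.Properties
open import Algebra.Properties.CommutativeSemigroup +-commutativeSemigroup using (xy∙z≈xz∙y; xy∙z≈zy∙x; x∙yz≈xz∙y)
open import Data.Product using (∃; _×_; _,_; proj₁; proj₂)
open import Data.Sum using (_⊎_; inj₁; inj₂; [_,_]; swap)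
open import Data.Vec.Functional using (updateAt)
open import Data.Vec.Functional.Properties using (updateAt-updates; updateAt-minimal)
open import Function using (_∘_; const; id)
open import Relation.Binary.PropositionalEquality using (_≡_; _≢_; refl; sym; trans; cong; subst; module ≡-Reasoning)
open import Relation.Nullary using (¬_; yes; no)
open import Relation.Nullary.Decidable using (decidable-stable; _⊎-dec_)

-- Adjacency is an arbitrary relation, so the extremal objects of the argument (a longest
-- path, a minimum-weight TRDF) are only obtained under a double negation.
excluded-middle : ∀ {ℓ} (P : Set ℓ) → ¬ ¬ (P ⊎ ¬ P)
excluded-middle P k = k (inj₂ (k ∘ inj₁))

Least Greatest : (ℕ → Set) → Set
Least P = ∃ λ m → P m × (∀ j → P j → m ≤ j)
Greatest P = ∃ λ m → P m × (∀ j → P j → j ≤ m)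

¬¬-least : ∀ {P : ℕ → Set} a → P a → ¬ ¬ Least P
¬¬-least {P} = <-rec _ λ a rec pa k → excluded-middle (∃ λ j → j < a × P j) λ
  { (inj₁ (j , j<a , pj)) → rec j<a pj k
  ; (inj₂ none) → k (a , pa , λ j pj → ≮⇒≥ λ j<a → none (j , j<a , pj)) }

-- The greatest j < B with P j is B ∸ d for the least d with P (B ∸ d).
¬¬-greatest : ∀ {P : ℕ → Set} B a → P a → (∀ j → P j → j < B) → ¬ ¬ Greatest P
¬¬-greatest {P} B a pa bounded k =
  ¬¬-least (B ∸ a) (reflect pa) λ (d , pd , least) →
    k (B ∸ d , pd , λ j pj →
      ≤-trans (≤-reflexive (sym (m∸[m∸n]≡n (<⇒≤ (bounded j pj)))))
              (∸-monoʳ-≤ B (least (B ∸ j) (reflect pj))))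
  where
  reflect : ∀ {j} → P j → P (B ∸ (B ∸ j))
  reflect {j} pj = subst P (sym (m∸[m∸n]≡n (<⇒≤ (bounded j pj)))) pj

-- Weights under pointwise updates

infixl 6 _[_]≔_
_[_]≔_ : ∀ {m} → (Fin m → ℕ) → Fin m → ℕ → Fin m → ℕ
f [ p ]≔ a = updateAt f p (const a)

weight≡sum-tabulate : ∀ G (f : Fin (n G) → ℕ) → weight G f ≡ sum (tabulate f)
weight≡sum-tabulate G f = cong sum (map-tabulate id f)

lookup≤sum-tabulate : ∀ {m} (f : Fin m → ℕ) i → f i ≤ sum (tabulate f)
lookup≤sum-tabulate f zero = m≤m+n _ _
lookup≤sum-tabulate f (suc i) = ≤-trans (lookup≤sum-tabulate (f ∘ suc) i) (m≤n+m _ _)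

sum-tabulate-updateAt : ∀ {m} (f : Fin m → ℕ) p a →
                        sum (tabulate (f [ p ]≔ a)) + f p ≡ sum (tabulate f) + a
sum-tabulate-updateAt f zero a = xy∙z≈zy∙x a _ (f zero)
sum-tabulate-updateAt f (suc p) a =
  begin
    (f zero + sum (tabulate (f ∘ suc [ p ]≔ a))) + f (suc p)
      ≡⟨ +-assoc (f zero) _ _ ⟩
    f zero + (sum (tabulate (f ∘ suc [ p ]≔ a)) + f (suc p))
      ≡⟨ cong (f zero +_) (sum-tabulate-updateAt (f ∘ suc) p a) ⟩
    f zero + (sum (tabulate (f ∘ suc)) + a)
      ≡⟨ +-assoc (f zero) _ a ⟨
    (f zero + sum (tabulate (f ∘ suc))) + a  ∎
  where open ≡-Reasoning

weight-updateAt : ∀ G (f : Fin (n G) → ℕ) p a → weight G (f [ p ]≔ a) + f p ≡ weight G f + a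
weight-updateAt G f p a
  rewrite weight≡sum-tabulate G (f [ p ]≔ a) | weight≡sum-tabulate G f = sum-tabulate-updateAt f p a

weight-updateAt-≤ : ∀ G (f : Fin (n G) → ℕ) p a → a ≤ f p + 1 → weight G (f [ p ]≔ a) ≤ weight G f + 1
weight-updateAt-≤ G f p a a≤ = +-cancelʳ-≤ (f p) _ _ (begin
  weight G (f [ p ]≔ a) + f p  ≡⟨ weight-updateAt G f p a ⟩
  weight G f + a               ≤⟨ +-monoʳ-≤ (weight G f) a≤ ⟩
  weight G f + (f p + 1)       ≡⟨ x∙yz≈xz∙y (weight G f) (f p) 1 ⟩
  weight G f + 1 + f p         ∎)
  where open ≤-Reasoning

weight-move : ∀ G (f : Fin (n G) → ℕ) {p q} a → q ≢ p →
              weight G (f [ p ]≔ 0 [ q ]≔ a) + f p + f q ≡ weight G f + a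
weight-move G f {p} {q} a q≢p = begin
  weight G g + f p + f q  ≡⟨ xy∙z≈xz∙y (weight G g) (f p) (f q) ⟩
  weight G g + f q + f p  ≡⟨ cong (λ t → weight G g + t + f p) (updateAt-minimal q p f q≢p) ⟨
  weight G g + h q + f p  ≡⟨ cong (_+ f p) (weight-updateAt G h q a) ⟩
  weight G h + a + f p    ≡⟨ xy∙z≈xz∙y (weight G h) a (f p) ⟩
  weight G h + f p + a    ≡⟨ cong (_+ a) (trans (weight-updateAt G f p 0) (+-identityʳ _)) ⟩
  weight G f + a          ∎
  where
  open ≡-Reasoning
  h = f [ p ]≔ 0
  g = h [ q ]≔ a

updateAt-≤2 : ∀ {m} (f : Fin m → ℕ) p a → (∀ v → f v ≤ 2) → a ≤ 2 → ∀ v → (f [ p ]≔ a) v ≤ 2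
updateAt-≤2 f p a f≤2 a≤2 v with v ≟ᶠ p
... | yes refl = subst (_≤ 2) (sym (updateAt-updates p f)) a≤2
... | no v≢p = subst (_≤ 2) (sym (updateAt-minimal v p f v≢p)) (f≤2 v)

infix 4 _≼_
_≼_ : ℕ → ℕ → Set
a ≼ b = (a ≡ 2 → b ≡ 2) × (0 < a → 0 < b)

≼-refl : ∀ {a} → a ≼ a
≼-refl = id , id

≼-updateAt : ∀ {m} (f : Fin m → ℕ) p a → f p ≼ a → ∀ u → f u ≼ (f [ p ]≔ a) u
≼-updateAt f p a fp≼a u with u ≟ᶠ p
... | yes refl rewrite updateAt-updates p {const a} f = fp≼a
... | no u≢p rewrite updateAt-minimal u p {const a} f u≢p = ≼-refl

-- From TRDFs of G + xy to TRDFs of G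

TotalRomanAt : (G : Graph) → (Fin (n G) → ℕ) → Fin (n G) → Set
TotalRomanAt G f v = (f v ≡ 0 → ∃ λ u → Adj G v u × f u ≡ 2) × (0 < f v → ∃ λ u → Adj G v u × 0 < f u)

isTRDF : ∀ G f → (∀ v → f v ≤ 2) → (∀ v → TotalRomanAt G f v) → IsTRDF G f
isTRDF G f f≤2 local = f≤2 , proj₁ ∘ local , proj₂ ∘ local

totalRomanAt-nbr≡2 : ∀ G f {v u} → Adj G v u → f u ≡ 2 → TotalRomanAt G f v
totalRomanAt-nbr≡2 G f v~u fu≡2 = (λ _ → _ , v~u , fu≡2) , (λ _ → _ , v~u , subst (0 <_) (sym fu≡2) z<s)

totalRomanAt-pos : ∀ G f {v u} → 0 < f v → Adj G v u → 0 < f u → TotalRomanAt G f v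
totalRomanAt-pos G f fv>0 v~u fu>0 = (λ fv≡0 → ⊥-elim (n>0⇒n≢0 fv>0 fv≡0)) , (λ _ → _ , v~u , fu>0)

weight-pos : ∀ G f → IsTRDF G f → Fin (n G) → 0 < weight G f
weight-pos G f (_ , dominated , _) v rewrite weight≡sum-tabulate G f with f v ≟ 0
... | no fv≢0 = <-≤-trans (n≢0⇒n>0 fv≢0) (lookup≤sum-tabulate f v)
... | yes fv≡0 with dominated v fv≡0
... | u , _ , fu≡2 = <-≤-trans (subst (0 <_) (sym fu≡2) z<s) (lookup≤sum-tabulate f u)

LeafAt : (G : Graph) → Fin (n G) → Fin (n G) → Set
LeafAt G x w = Adj G x w × (∀ z → Adj G x z → z ≡ w)

TRDFWithin : (G : Graph) → ℕ → Set
TRDFWithin G k = ∃ λ g → IsTRDF G g × weight G g ≤ k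

DropsAtMostOne : (G : Graph) (x y : Fin (n G)) → x ≢ y → Set
DropsAtMostOne G x y x≢y = ∀ f → IsTRDF (addEdge G x y x≢y) f → TRDFWithin G (weight G f + 1)

record NonCriticalPair (G : Graph) : Set where
  field
    x y            : Fin (n G)
    nonEdge        : NonEdge G x y
    dropsAtMostOne : DropsAtMostOne G x y (proj₁ nonEdge)

adj⇒≢ : ∀ G {u v} → Adj G u v → u ≢ v
adj⇒≢ G u~v refl = irref G u~v

module AddEdge (G : Graph) {x y : Fin (n G)} (x≢y : x ≢ y) where
  G+xy : Graph
  G+xy = addEdge G x y x≢y

  adj-other : ∀ {v u} → v ≢ x → v ≢ y → Adj G+xy v u → Adj G v u
  adj-other _ _ (inj₁ v~u) = v~u
  adj-other v≢x _ (inj₂ (inj₁ (v≡x , _))) = ⊥-elim (v≢x v≡x)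
  adj-other _ v≢y (inj₂ (inj₂ (v≡y , _))) = ⊥-elim (v≢y v≡y)

  adj-x : ∀ {u} → Adj G+xy x u → Adj G x u ⊎ u ≡ y
  adj-x (inj₁ x~u) = inj₁ x~u
  adj-x (inj₂ (inj₁ (_ , u≡y))) = inj₂ u≡y
  adj-x (inj₂ (inj₂ (x≡y , _))) = ⊥-elim (x≢y x≡y)

  adj-y : ∀ {u} → Adj G+xy y u → Adj G y u ⊎ u ≡ x
  adj-y (inj₁ y~u) = inj₁ y~u
  adj-y (inj₂ (inj₁ (y≡x , _))) = ⊥-elim (x≢y (sym y≡x))
  adj-y (inj₂ (inj₂ (_ , u≡x))) = inj₂ u≡x

  module _ {f : Fin (n G) → ℕ} (trd : IsTRDF G+xy f) where
    dominated : ∀ v → f v ≡ 0 → ∃ λ u → Adj G+xy v u × f u ≡ 2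
    dominated = proj₁ (proj₂ trd)

    paired : ∀ v → 0 < f v → ∃ λ u → Adj G+xy v u × 0 < f u
    paired = proj₂ (proj₂ trd)

    -- Away from x and y, G and G + xy have the same neighbourhoods.
    totalRomanAt-inherit : ∀ g v → v ≢ x → v ≢ y → (∀ u → Adj G v u → f u ≼ g u) →
                           (f v ≡ 0 → g v ≡ 0) → (g v ≡ 0 → f v ≡ 0) → TotalRomanAt G g v
    totalRomanAt-inherit g v v≢x v≢y nbrs≼ f0⇒g0 g0⇒f0 =
      (λ gv≡0 → let u , v~u , fu≡2 = dominated v (g0⇒f0 gv≡0)
                    v~ᴳu = adj-other v≢x v≢y v~u
                in u , v~ᴳu , proj₁ (nbrs≼ u v~ᴳu) fu≡2) ,
      (λ gv>0 → let u , v~u , fu>0 = paired v (n≢0⇒n>0 (n>0⇒n≢0 gv>0 ∘ f0⇒g0))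
                    v~ᴳu = adj-other v≢x v≢y v~u
                in u , v~ᴳu , proj₂ (nbrs≼ u v~ᴳu) fu>0)

    updateAt-isTRDF : ∀ p a → a ≤ 2 → f p ≼ a →
                      TotalRomanAt G (f [ p ]≔ a) x → TotalRomanAt G (f [ p ]≔ a) y →
                      TotalRomanAt G (f [ p ]≔ a) p → IsTRDF G (f [ p ]≔ a)
    updateAt-isTRDF p a a≤2 fp≼a at-x at-y at-p = isTRDF G g (updateAt-≤2 f p a (proj₁ trd) a≤2) local
      where
      g = f [ p ]≔ a
      local : ∀ v → TotalRomanAt G g v
      local v with v ≟ᶠ x | v ≟ᶠ y | v ≟ᶠ p
      ... | yes refl | _ | _ = at-x
      ... | no _ | yes refl | _ = at-y
      ... | no _ | no _ | yes refl = at-p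
      ... | no v≢x | no v≢y | no v≢p =
        totalRomanAt-inherit g v v≢x v≢y (λ u _ → ≼-updateAt f p a fp≼a u)
          (trans gv≡fv) (trans (sym gv≡fv))
        where gv≡fv = updateAt-minimal v p f v≢p

    raise-to-2 : ∀ p → Adj G x p → Adj G y p → 0 < f p → TRDFWithin G (weight G f + 1)
    raise-to-2 p x~p y~p fp>0 =
      g , updateAt-isTRDF p 2 ≤-refl fp≼2 (totalRomanAt-nbr≡2 G g x~p gp≡2)
                         (totalRomanAt-nbr≡2 G g y~p gp≡2) at-p
        , weight-updateAt-≤ G f p 2 (+-monoˡ-≤ 1 fp>0)
      where
      g = f [ p ]≔ 2
      gp≡2 : g p ≡ 2
      gp≡2 = updateAt-updates p f
      fp≼2 : f p ≼ 2
      fp≼2 = const refl , const z<s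
      at-p : TotalRomanAt G g p
      at-p = totalRomanAt-inherit g p (adj⇒≢ G x~p ∘ sym) (adj⇒≢ G y~p ∘ sym)
               (λ u _ → ≼-updateAt f p 2 fp≼2 u)
               (λ fp≡0 → ⊥-elim (n>0⇒n≢0 fp>0 fp≡0)) (λ gp≡0 → ⊥-elim (0≢1+n (trans (sym gp≡0) gp≡2)))

    raise-to-1 : ∀ p → f p ≡ 0 → Adj G x p → 0 < f x → TotalRomanAt G (f [ p ]≔ 1) y →
                 TRDFWithin G (weight G f + 1)
    raise-to-1 p fp≡0 x~p fx>0 at-y =
      g , updateAt-isTRDF p 1 (s≤s z≤n) fp≼1 (totalRomanAt-pos G g gx>0 x~p gp>0) at-y
                         (totalRomanAt-pos G g gp>0 (Graph.sym G x~p) gx>0)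
        , weight-updateAt-≤ G f p 1 (≤-reflexive (cong (_+ 1) (sym fp≡0)))
      where
      g = f [ p ]≔ 1
      fp≼1 : f p ≼ 1
      fp≼1 = (λ fp≡2 → ⊥-elim (0≢1+n (trans (sym fp≡0) fp≡2))) , (λ fp>0 → ⊥-elim (n>0⇒n≢0 fp>0 fp≡0))
      gp>0 : 0 < g p
      gp>0 = subst (0 <_) (sym (updateAt-updates p f)) z<s
      gx>0 : 0 < g x
      gx>0 = subst (0 <_) (sym (updateAt-minimal x p f (adj⇒≢ G x~p))) fx>0

    leaf-support-pos : ∀ {v w} → v ≢ x → v ≢ y → LeafAt G v w → 0 < f w
    leaf-support-pos {v} v≢x v≢y (_ , only-w) with f v ≟ 0
    ... | yes fv≡0 = let u , v~u , fu≡2 = dominated v fv≡0 in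
                     subst (λ t → 0 < f t) (only-w u (adj-other v≢x v≢y v~u)) (subst (0 <_) (sym fu≡2) z<s)
    ... | no fv≢0 = let u , v~u , fu>0 = paired v (n≢0⇒n>0 fv≢0) in
                    subst (λ t → 0 < f t) (only-w u (adj-other v≢x v≢y v~u)) fu>0

record Cherry (G : Graph) : Set where
  field
    centre leaf₁ leaf₂ : Fin (n G)
    leaf₁≢leaf₂ : leaf₁ ≢ leaf₂
    leaf₁-at : LeafAt G leaf₁ centre
    leaf₂-at : LeafAt G leaf₂ centre

module _ {G : Graph} (cherry : Cherry G) where
  open Cherry cherry renaming (centre to w; leaf₁ to x; leaf₂ to y)
  open AddEdge G leaf₁≢leaf₂

  cherry-nonEdge : NonEdge G x y
  cherry-nonEdge = leaf₁≢leaf₂ , λ x~y → adj⇒≢ G (proj₁ leaf₂-at) (proj₂ leaf₁-at y x~y)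

  private
    nbrs-x : ∀ {u} → Adj G+xy x u → u ≡ w ⊎ u ≡ y
    nbrs-x x~u with adj-x x~u
    ... | inj₁ x~ᴳu = inj₁ (proj₂ leaf₁-at _ x~ᴳu)
    ... | inj₂ u≡y = inj₂ u≡y

    nbrs-y : ∀ {u} → Adj G+xy y u → u ≡ w ⊎ u ≡ x
    nbrs-y y~u with adj-y y~u
    ... | inj₁ y~ᴳu = inj₁ (proj₂ leaf₂-at _ y~ᴳu)
    ... | inj₂ u≡x = inj₂ u≡x

  -- If a were 0 it would need b = 2, and b would then have no positive neighbour.
  cherry-leaf-pos : ∀ {f} → IsTRDF G+xy f → f w ≡ 0 → ∀ {a b} →
                    (∀ {u} → Adj G+xy a u → u ≡ w ⊎ u ≡ b) →
                    (∀ {u} → Adj G+xy b u → u ≡ w ⊎ u ≡ a) → 0 < f a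
  cherry-leaf-pos {f} trd fw≡0 {a} {b} nbrs-a nbrs-b with f a ≟ 0
  ... | no fa≢0 = n≢0⇒n>0 fa≢0
  ... | yes fa≡0 with dominated trd a fa≡0
  ... | u , a~u , fu≡2 with nbrs-a a~u
  ... | inj₁ refl = ⊥-elim (0≢1+n (trans (sym fw≡0) fu≡2))
  ... | inj₂ refl with paired trd u (subst (0 <_) (sym fu≡2) z<s)
  ... | t , u~t , ft>0 with nbrs-b u~t
  ... | inj₁ refl = ⊥-elim (n>0⇒n≢0 ft>0 fw≡0)
  ... | inj₂ refl = ⊥-elim (n>0⇒n≢0 ft>0 fa≡0)

  cherry-dropsAtMostOne : DropsAtMostOne G x y leaf₁≢leaf₂
  cherry-dropsAtMostOne f trd with f w ≟ 0
  ... | no fw≢0 = raise-to-2 trd w (proj₁ leaf₁-at) (proj₁ leaf₂-at) (n≢0⇒n>0 fw≢0)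
  ... | yes fw≡0 =
    raise-to-1 trd w fw≡0 (proj₁ leaf₁-at) (cherry-leaf-pos trd fw≡0 nbrs-x nbrs-y)
      (totalRomanAt-pos G g gy>0 (proj₁ leaf₂-at) (subst (0 <_) (sym (updateAt-updates w f)) z<s))
    where
    g = f [ w ]≔ 1
    gy>0 : 0 < g y
    gy>0 = subst (0 <_) (sym (updateAt-minimal y w f (adj⇒≢ G (proj₁ leaf₂-at))))
                 (cherry-leaf-pos trd fw≡0 nbrs-y nbrs-x)

  cherry-nonCriticalPair : NonCriticalPair G
  cherry-nonCriticalPair = record { nonEdge = cherry-nonEdge ; dropsAtMostOne = cherry-dropsAtMostOne }

record PendantPath (G : Graph) : Set where
  field
    v₀ v₁ v₂ v₃ : Fin (n G)
    v₀-at : LeafAt G v₀ v₁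
    v₁~v₂ : Adj G v₁ v₂
    v₁-nbrs : ∀ z → Adj G v₁ z → z ≡ v₀ ⊎ z ≡ v₂
    v₂~v₃ : Adj G v₂ v₃
    v₃≢v₁ : v₃ ≢ v₁

module _ {G : Graph} (path : PendantPath G) where
  open PendantPath path

  private
    v₁≢v₃ : v₁ ≢ v₃
    v₁≢v₃ = v₃≢v₁ ∘ sym
    v₀≢v₁ : v₀ ≢ v₁
    v₀≢v₁ = adj⇒≢ G (proj₁ v₀-at)
    v₁≢v₂ : v₁ ≢ v₂
    v₁≢v₂ = adj⇒≢ G v₁~v₂
    v₂≢v₃ : v₂ ≢ v₃
    v₂≢v₃ = adj⇒≢ G v₂~v₃
    v₀≢v₂ : v₀ ≢ v₂
    v₀≢v₂ refl = v₃≢v₁ (proj₂ v₀-at v₃ v₂~v₃)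
    v₀≢v₃ : v₀ ≢ v₃
    v₀≢v₃ refl = v₁≢v₂ (sym (proj₂ v₀-at v₂ (Graph.sym G v₂~v₃)))

  open AddEdge G v₁≢v₃

  pendantPath-nonEdge : NonEdge G v₁ v₃
  pendantPath-nonEdge = v₁≢v₃ , λ v₁~v₃ → [ v₀≢v₃ ∘ sym , v₂≢v₃ ∘ sym ] (v₁-nbrs v₃ v₁~v₃)

  module _ {f : Fin (n G) → ℕ} (trd : IsTRDF G+xy f) (fv₂≡0 : f v₂ ≡ 0) where
    -- Move the weight of v₀ onto v₂: v₀ is then dominated by v₁, and v₂ dominates v₃.
    shift-to-v₂ : f v₁ ≡ 2 → f v₃ ≡ 0 → TRDFWithin G (weight G f + 1)
    shift-to-v₂ fv₁≡2 fv₃≡0 = g , isTRDF G g g≤2 local , weight-g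
      where
      h = f [ v₀ ]≔ 0
      g = h [ v₂ ]≔ 2
      fv₀>0 : 0 < f v₀
      fv₀>0 with paired trd v₁ (subst (0 <_) (sym fv₁≡2) z<s)
      ... | u , v₁~u , fu>0 with adj-x v₁~u
      ... | inj₂ refl = ⊥-elim (n>0⇒n≢0 fu>0 fv₃≡0)
      ... | inj₁ v₁~ᴳu with v₁-nbrs u v₁~ᴳu
      ... | inj₁ refl = fu>0
      ... | inj₂ refl = ⊥-elim (n>0⇒n≢0 fu>0 fv₂≡0)
      g≡f : ∀ {v} → v ≢ v₀ → v ≢ v₂ → g v ≡ f v
      g≡f v≢v₀ v≢v₂ = trans (updateAt-minimal _ v₂ h v≢v₂) (updateAt-minimal _ v₀ f v≢v₀)
      gv₂≡2 : g v₂ ≡ 2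
      gv₂≡2 = updateAt-updates v₂ h
      gv₁≡2 : g v₁ ≡ 2
      gv₁≡2 = trans (g≡f (v₀≢v₁ ∘ sym) v₁≢v₂) fv₁≡2
      g≤2 : ∀ v → g v ≤ 2
      g≤2 = updateAt-≤2 h v₂ 2 (updateAt-≤2 f v₀ 0 (proj₁ trd) z≤n) ≤-refl
      local : ∀ v → TotalRomanAt G g v
      local v with v ≟ᶠ v₀ | v ≟ᶠ v₁ | v ≟ᶠ v₂ | v ≟ᶠ v₃
      ... | yes refl | _ | _ | _ = totalRomanAt-nbr≡2 G g (proj₁ v₀-at) gv₁≡2
      ... | no _ | yes refl | _ | _ = totalRomanAt-nbr≡2 G g v₁~v₂ gv₂≡2
      ... | no _ | no _ | yes refl | _ = totalRomanAt-nbr≡2 G g (Graph.sym G v₁~v₂) gv₁≡2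
      ... | no _ | no _ | no _ | yes refl = totalRomanAt-nbr≡2 G g (Graph.sym G v₂~v₃) gv₂≡2
      ... | no v≢v₀ | no v≢v₁ | no v≢v₂ | no v≢v₃ =
        totalRomanAt-inherit trd g v v≢v₁ v≢v₃ nbrs≼ (trans (g≡f v≢v₀ v≢v₂)) (trans (sym (g≡f v≢v₀ v≢v₂)))
        where
        nbrs≼ : ∀ u → Adj G v u → f u ≼ g u
        nbrs≼ u v~u with u ≟ᶠ v₂ | u ≟ᶠ v₀
        ... | yes refl | _ = const gv₂≡2 , const (subst (0 <_) (sym gv₂≡2) z<s)
        ... | no _ | yes refl = ⊥-elim (v≢v₁ (proj₂ v₀-at v (Graph.sym G v~u)))
        ... | no u≢v₂ | no u≢v₀ rewrite g≡f u≢v₀ u≢v₂ = ≼-refl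
      weight-g : weight G g ≤ weight G f + 1
      weight-g = +-cancelʳ-≤ (f v₀) _ _ (begin
        weight G g + f v₀          ≡⟨ +-identityʳ _ ⟨
        weight G g + f v₀ + 0      ≡⟨ cong (weight G g + f v₀ +_) fv₂≡0 ⟨
        weight G g + f v₀ + f v₂   ≡⟨ weight-move G f 2 (v₀≢v₂ ∘ sym) ⟩
        weight G f + 2             ≡⟨ +-assoc (weight G f) 1 1 ⟨
        weight G f + 1 + 1         ≤⟨ +-monoʳ-≤ (weight G f + 1) fv₀>0 ⟩
        weight G f + 1 + f v₀      ∎)
        where open ≤-Reasoning

    v₃-settled : TotalRomanAt G (f [ v₂ ]≔ 1) v₃ ⊎ (f v₁ ≡ 2 × f v₃ ≡ 0)
    v₃-settled with f v₃ ≟ 0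
    ... | no fv₃≢0 = inj₁ (totalRomanAt-pos G g gv₃>0 (Graph.sym G v₂~v₃) gv₂>0)
      where
      g = f [ v₂ ]≔ 1
      gv₃>0 : 0 < g v₃
      gv₃>0 = subst (0 <_) (sym (updateAt-minimal v₃ v₂ f (v₂≢v₃ ∘ sym))) (n≢0⇒n>0 fv₃≢0)
      gv₂>0 : 0 < g v₂
      gv₂>0 = subst (0 <_) (sym (updateAt-updates v₂ f)) z<s
    ... | yes fv₃≡0 with dominated trd v₃ fv₃≡0
    ... | u , v₃~u , fu≡2 with adj-y v₃~u
    ... | inj₂ refl = inj₂ (fu≡2 , fv₃≡0)
    ... | inj₁ v₃~ᴳu = inj₁ (totalRomanAt-nbr≡2 G (f [ v₂ ]≔ 1) v₃~ᴳu (trans (updateAt-minimal u v₂ f u≢v₂) fu≡2))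
      where
      u≢v₂ : u ≢ v₂
      u≢v₂ refl = 0≢1+n (trans (sym fv₂≡0) fu≡2)

  pendantPath-dropsAtMostOne : DropsAtMostOne G v₁ v₃ v₁≢v₃
  pendantPath-dropsAtMostOne f trd with f v₂ ≟ 0
  ... | no fv₂≢0 = raise-to-2 trd v₂ v₁~v₂ (Graph.sym G v₂~v₃) (n≢0⇒n>0 fv₂≢0)
  ... | yes fv₂≡0 with v₃-settled trd fv₂≡0
  ... | inj₁ at-v₃ = raise-to-1 trd v₂ fv₂≡0 v₁~v₂ (leaf-support-pos trd v₀≢v₁ v₀≢v₃ v₀-at) at-v₃
  ... | inj₂ (fv₁≡2 , fv₃≡0) = shift-to-v₂ trd fv₂≡0 fv₁≡2 fv₃≡0

  pendantPath-nonCriticalPair : NonCriticalPair G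
  pendantPath-nonCriticalPair =
    record { nonEdge = pendantPath-nonEdge ; dropsAtMostOne = pendantPath-dropsAtMostOne }

-- Supercriticality

ones-isTRDF : ∀ G → NoIsolated G → IsTRDF G (const 1)
ones-isTRDF G noIso = const (s≤s z≤n) , (λ _ ()) , (λ v _ → proj₁ (noIso v) , proj₂ (noIso v) , z<s)

¬¬-γtR : ∀ G → NoIsolated G → ¬ ¬ ∃ (IsγtR G)
¬¬-γtR G noIso k =
  ¬¬-least {λ w → ∃ λ f → IsTRDF G f × weight G f ≡ w} _ (const 1 , ones-isTRDF G noIso , refl)
    λ (w , attained , least) → k (w , attained , λ f trd → least _ (f , trd , refl))

addEdge-noIsolated : ∀ G {x y} (x≢y : x ≢ y) → NoIsolated G → NoIsolated (addEdge G x y x≢y)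
addEdge-noIsolated G x≢y noIso v = proj₁ (noIso v) , inj₁ (proj₂ (noIso v))

m≤n+1⇒n≤m∸2⇒n≡0 : ∀ {m} n → m ≤ n + 1 → n ≤ m ∸ 2 → n ≡ 0
m≤n+1⇒n≤m∸2⇒n≡0 zero _ _ = refl
m≤n+1⇒n≤m∸2⇒n≡0 {m} (suc n) m≤n+2 n+1≤m∸2 = ⊥-elim (1+n≰n (begin
  suc n          ≤⟨ n+1≤m∸2 ⟩
  m ∸ 2          ≤⟨ ∸-monoˡ-≤ 2 m≤n+2 ⟩
  suc n + 1 ∸ 2  ≡⟨ m+n∸n≡m n 1 ⟩
  n              ∎))
  where open ≤-Reasoning

supercritical⇒¬nonCriticalPair : ∀ {G} → EdgeSupercritical G → ¬ NonCriticalPair G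
supercritical⇒¬nonCriticalPair {G} (noIso , _ , critical) pair =
  ¬¬-γtR G noIso λ (k , γ) →
  ¬¬-γtR G+xy (addEdge-noIsolated G (proj₁ xy) noIso) λ (k′ , γ′) →
    let f , trd , wf≡k′ = proj₁ γ′
        g , trd-g , wg≤wf+1 = drops f trd
        k≤k′+1 = ≤-trans (proj₂ γ g trd-g) (subst (λ t → weight G g ≤ t + 1) wf≡k′ wg≤wf+1)
    in n>0⇒n≢0 (subst (0 <_) wf≡k′ (weight-pos G+xy f trd x))
               (m≤n+1⇒n≤m∸2⇒n≡0 k′ k≤k′+1 (critical x y xy k k′ γ γ′))
  where
  open NonCriticalPair pair renaming (nonEdge to xy; dropsAtMostOne to drops)
  G+xy = addEdge G x y (proj₁ xy)

-- Longest paths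

isolatedEdge-reach : ∀ G {a b v} → LeafAt G a b → LeafAt G b a → Walk G a v → v ≡ a ⊎ v ≡ b
isolatedEdge-reach G _ _ here = inj₁ refl
isolatedEdge-reach G a-at@(_ , only-b) b-at (step a~w walk) with only-b _ a~w
... | refl = swap (isolatedEdge-reach G b-at a-at walk)

connected-isolatedEdge⇒¬nonEdge : ∀ G {a b u v} → Connected G → LeafAt G a b → LeafAt G b a → ¬ NonEdge G u v
connected-isolatedEdge⇒¬nonEdge G {a} {u = u} {v} connected a-at b-at (u≢v , u≁v)
  with isolatedEdge-reach G a-at b-at (connected a u) | isolatedEdge-reach G a-at b-at (connected a v)
... | inj₁ refl | inj₁ refl = u≢v refl
... | inj₂ refl | inj₂ refl = u≢v refl
... | inj₁ refl | inj₂ refl = u≁v (proj₁ a-at)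
... | inj₂ refl | inj₁ refl = u≁v (proj₁ b-at)

module Paths (G : Graph) where
  -- Only the vertices at indices i ≤ ℓ belong to the path.
  record Path (ℓ : ℕ) : Set where
    field
      vertex    : ℕ → Fin (n G)
      injective : ∀ {i j} → i ≤ ℓ → j ≤ ℓ → vertex i ≡ vertex j → i ≡ j
      adjacent  : ∀ {i} → i < ℓ → Adj G (vertex i) (vertex (suc i))
  open Path public

  Longest : ∀ {ℓ} → Path ℓ → Set
  Longest {ℓ} _ = ∀ j → Path j → j ≤ ℓ

  trivial : Fin (n G) → Path 0
  trivial v = record
    { vertex = const v
    ; injective = λ i≤0 j≤0 _ → trans (n≤0⇒n≡0 i≤0) (sym (n≤0⇒n≡0 j≤0))
    ; adjacent = λ () }

  cons : ∀ {ℓ} z (p : Path ℓ) → Adj G z (vertex p 0) → (∀ j → j ≤ ℓ → vertex p j ≢ z) → Path (suc ℓ)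
  cons {ℓ} z p z~p₀ off-p = record { vertex = vertex′ ; injective = injective′ ; adjacent = adjacent′ }
    where
    vertex′ : ℕ → Fin (n G)
    vertex′ zero = z
    vertex′ (suc i) = vertex p i
    injective′ : ∀ {i j} → i ≤ suc ℓ → j ≤ suc ℓ → vertex′ i ≡ vertex′ j → i ≡ j
    injective′ {zero} {zero} _ _ _ = refl
    injective′ {zero} {suc j} _ j≤ e = ⊥-elim (off-p j (s≤s⁻¹ j≤) (sym e))
    injective′ {suc i} {zero} i≤ _ e = ⊥-elim (off-p i (s≤s⁻¹ i≤) e)
    injective′ {suc i} {suc j} i≤ j≤ e = cong suc (injective p (s≤s⁻¹ i≤) (s≤s⁻¹ j≤) e)
    adjacent′ : ∀ {i} → i < suc ℓ → Adj G (vertex′ i) (vertex′ (suc i))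
    adjacent′ {zero} _ = z~p₀
    adjacent′ {suc i} i<ℓ = adjacent p (s≤s⁻¹ i<ℓ)

  edge : ∀ {a b} → Adj G a b → Path 1
  edge a~b = cons _ (trivial _) a~b λ { zero _ refl → irref G a~b }

  tail : ∀ {ℓ} → Path (suc ℓ) → Path ℓ
  tail p = record
    { vertex = vertex p ∘ suc
    ; injective = λ i≤ j≤ e → suc-injective (injective p (s≤s i≤) (s≤s j≤) e)
    ; adjacent = λ i<ℓ → adjacent p (s<s i<ℓ) }

  length<n : ∀ {ℓ} → Path ℓ → ℓ < n G
  length<n p = ≰⇒> λ n≤ℓ →
    let i , j , i<j , same = pigeonhole (s≤s n≤ℓ) (vertex p ∘ toℕ)
    in <⇒≢ i<j (injective p (s≤s⁻¹ (toℕ<n i)) (s≤s⁻¹ (toℕ<n j)) same)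

  ¬¬-longest : ∀ {ℓ} → Path ℓ → ¬ ¬ Greatest Path
  ¬¬-longest p = ¬¬-greatest (n G) _ p (λ _ → length<n)

  closing-cycle : ∀ {ℓ j} (p : Path ℓ) → 2 ≤ j → j ≤ ℓ → Adj G (vertex p j) (vertex p 0) → Cycle G
  closing-cycle {ℓ} {j} p 2≤j j≤ℓ pⱼ~p₀ = record
    { m = j
    ; m≥2 = 2≤j
    ; c = vertex p ∘ toℕ
    ; inj = λ {i} {i′} e → toℕ-injective (injective p (bound i) (bound i′) e)
    ; consec = λ i → subst (λ t → Adj G (vertex p t) (vertex p (suc (toℕ i)))) (sym (toℕ-inject₁ i))
                           (adjacent p (<-≤-trans (toℕ<n i) j≤ℓ))
    ; close = subst (λ t → Adj G (vertex p t) (vertex p 0)) (sym (toℕ-fromℕ j)) pⱼ~p₀ }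
    where
    bound : (i : Fin (suc j)) → toℕ i ≤ ℓ
    bound i = ≤-trans (s≤s⁻¹ (toℕ<n i)) j≤ℓ

  module _ (acyclic : Acyclic G) where
    -- A neighbour off the path would extend it; one further along would close a cycle.
    longest-start-isLeaf : ∀ {ℓ} (p : Path (suc ℓ)) → Longest p → LeafAt G (vertex p 0) (vertex p 1)
    longest-start-isLeaf {ℓ} p longest = adjacent p z<s , λ z p₀~z →
      decidable-stable (z ≟ᶠ vertex p 1) λ z≢p₁ →
      excluded-middle (∃ λ j → j ≤ suc ℓ × vertex p j ≡ z) λ
        { (inj₂ off-p) → 1+n≰n (longest _ (cons z p (Graph.sym G p₀~z) λ j j≤ e → off-p (j , j≤ , e)))
        ; (inj₁ (zero , _ , refl)) → irref G p₀~z
        ; (inj₁ (suc zero , _ , refl)) → z≢p₁ refl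
        ; (inj₁ (suc (suc j) , j≤ , refl)) → acyclic (closing-cycle p (s≤s (s≤s z≤n)) j≤ (Graph.sym G p₀~z)) }

    -- Replacing the start of p by z gives another longest path.
    longest-second-nbr-isLeaf : ∀ {ℓ} (p : Path (suc (suc ℓ))) → Longest p →
                                ∀ z → Adj G (vertex p 1) z → z ≢ vertex p 2 → LeafAt G z (vertex p 1)
    longest-second-nbr-isLeaf p longest z p₁~z z≢p₂ =
      longest-start-isLeaf (cons z (tail p) (Graph.sym G p₁~z) off-tail) longest
      where
      off-tail : ∀ j → j ≤ _ → vertex p (suc j) ≢ z
      off-tail zero _ refl = irref G p₁~z
      off-tail (suc zero) _ refl = z≢p₂ refl
      off-tail (suc (suc j)) j≤ refl = acyclic (closing-cycle (tail p) (s≤s (s≤s z≤n)) j≤ (Graph.sym G p₁~z))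

    longest⇒cherry-or-pendantPath : ∀ {ℓ} (p : Path (suc (suc ℓ))) → Longest p →
                                    ¬ ¬ (Cherry G ⊎ PendantPath G)
    longest⇒cherry-or-pendantPath p longest k =
      excluded-middle (∃ λ z → Adj G p₁ z × z ≢ p₀ × z ≢ p₂) λ
        { (inj₁ (z , p₁~z , z≢p₀ , z≢p₂)) → k (inj₁ (cherry-with z (z≢p₀ ∘ sym) (leaf-at z p₁~z z≢p₂)))
        ; (inj₂ no-third) → excluded-middle (∃ λ t → Adj G p₂ t × t ≢ p₁) λ
          { (inj₁ (t , p₂~t , t≢p₁)) → k (inj₂ (record
              { v₀ = p₀ ; v₁ = p₁ ; v₂ = p₂ ; v₃ = t ; v₀-at = p₀-at ; v₁~v₂ = p₁~p₂
              ; v₁-nbrs = λ z p₁~z → decidable-stable ((z ≟ᶠ p₀) ⊎-dec (z ≟ᶠ p₂)) λ z∉ →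
                  no-third (z , p₁~z , z∉ ∘ inj₁ , z∉ ∘ inj₂)
              ; v₂~v₃ = p₂~t ; v₃≢v₁ = t≢p₁ }))
          ; (inj₂ p₂-leaf) → k (inj₁ (cherry-with p₂ p₀≢p₂ (Graph.sym G p₁~p₂ , λ t p₂~t →
              decidable-stable (t ≟ᶠ p₁) λ t≢p₁ → p₂-leaf (t , p₂~t , t≢p₁)))) } }
      where
      p₀ = vertex p 0
      p₁ = vertex p 1
      p₂ = vertex p 2
      p₁~p₂ : Adj G p₁ p₂
      p₁~p₂ = adjacent p (s<s z<s)
      p₀≢p₂ : p₀ ≢ p₂
      p₀≢p₂ e with injective p z≤n (s≤s (s≤s z≤n)) e
      ... | ()
      leaf-at : ∀ z → Adj G p₁ z → z ≢ p₂ → LeafAt G z p₁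
      leaf-at = longest-second-nbr-isLeaf p longest
      p₀-at : LeafAt G p₀ p₁
      p₀-at = longest-start-isLeaf p longest
      cherry-with : ∀ y → p₀ ≢ y → LeafAt G y p₁ → Cherry G
      cherry-with y p₀≢y y-at = record
        { centre = p₁ ; leaf₁ = p₀ ; leaf₂ = y ; leaf₁≢leaf₂ = p₀≢y ; leaf₁-at = p₀-at ; leaf₂-at = y-at }

    tree⇒cherry-or-pendantPath : Connected G → NoIsolated G → ∀ {u v} → NonEdge G u v →
                                 ¬ ¬ (Cherry G ⊎ PendantPath G)
    tree⇒cherry-or-pendantPath connected noIso {u} uv k = ¬¬-longest (edge (proj₂ (noIso u))) λ
      { (zero , _ , longest) → 1+n≰n (longest _ (edge (proj₂ (noIso u))))
      ; (suc zero , p , longest) →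
          connected-isolatedEdge⇒¬nonEdge G connected (longest-start-isLeaf p longest)
            (longest-start-isLeaf (edge (Graph.sym G (adjacent p z<s))) longest) uv
      ; (suc (suc _) , p , longest) → longest⇒cherry-or-pendantPath p longest k }

corollary4p6 : ∀ (G : Graph) → IsTree G → ¬ EdgeSupercritical G
corollary4p6 G (connected , acyclic) supercritical@(noIso , (_ , _ , uv) , _) =
  tree⇒cherry-or-pendantPath acyclic connected noIso uv
    (supercritical⇒¬nonCriticalPair {G} supercritical ∘ [ cherry-nonCriticalPair , pendantPath-nonCriticalPair ])
  where open Paths G
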